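{- Let $q$ be a complex number with $q\neq 0,1$, let $m,r$ be complex numbers, and write $[i]_q=\frac{q^i-1}{q-1}$. For all integers $0\le k\le n$, the $(q,r)$-Whitney numbers of the first kind satisfy $$w_{m,r,q}(n,k)=(-1)^{n-k}q^{ -\binom{n}{2}}\sum_{0\leq i_1<i_2<\cdots<i_{n-k}\leq n-1}\ \prod_{j=1}^{n-k}\big(r+[i_j]_q\,m\big).$$
   Context: The $(q,r)$-Whitney numbers of the first kind $w_{m,r,q}(n,k)$ are defined as the coefficients in $m^n(a^\dagger)^n a^n=\sum_{k=0}^{n}w_{m,r,q}(n,k)(ma^\dagger a+r)^k$, where $a^\dagger,a$ are $q$-boson operators satisfying $aa^\dagger-qa^\dagger a=1$. Equivalently, they are the unique numbers with $w_{m,r,q}(0,0)=1$, $w_{m,r,q}(n,k)=0$ for $k<0$ or $k>n$, and the recurrence $w_{m,r,q}(n+1,k)=q^{ -n}\big(w_{m,r,q}(n,k-1)-(m[n]_q+r)w_{m,r,q}(n,k)\big)$ for $n\ge 0$. An empty sum-over-products (when $n=k$) has the single empty product equal to $1$. -}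

module Defs where

open import Level using (Level)
open import Data.Nat using (ℕ; zero; suc)
open import Data.List using (List; []; _∷_; _++_; map; _∷ʳ_)
open import Algebra.Bundles using (CommutativeRing)

-- All strictly increasing lists (i₁ < i₂ < ⋯ < i_ℓ) of length ℓ with
-- entries in {0, …, n-1}.  incSeqs n ℓ enumerates each exactly once.
incSeqs : ℕ → ℕ → List (List ℕ)
incSeqs n       zero    = [] ∷ []
incSeqs zero    (suc ℓ) = []
incSeqs (suc n) (suc ℓ) = incSeqs n (suc ℓ) ++ map (λ is → is ∷ʳ n) (incSeqs n ℓ)

module Whitney {c ℓ : Level} (R : CommutativeRing c ℓ) where
  open CommutativeRing R hiding (zero)

  pow : Carrier → ℕ → Carrier
  pow x zero    = 1#
  pow x (suc n) = x * pow x n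

  sumL : List Carrier → Carrier
  sumL []       = 0#
  sumL (x ∷ xs) = x + sumL xs

  prodL : List Carrier → Carrier
  prodL []       = 1#
  prodL (x ∷ xs) = x * prodL xs

  -- q-number [i]_q = (q^i - 1)/(q - 1), where d is the inverse of (q - 1)
  qnum : (q d : Carrier) → ℕ → Carrier
  qnum q d i = (pow q i - 1#) * d

  -- (q,r)-Whitney numbers of the first kind w_{m,r,q}(n,k), via the recurrence
  --   w(0,0) = 1, w(0,k) = 0 for k > 0, w(n,-1) = 0,
  --   w(n+1,k) = q^{-n} ( w(n,k-1) - (m [n]_q + r) w(n,k) ).
  -- q⁻¹ is the inverse of q, d the inverse of q - 1.
  w : (q q⁻¹ d m r : Carrier) → ℕ → ℕ → Carrier
  w q q⁻¹ d m r zero    zero    = 1#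
  w q q⁻¹ d m r zero    (suc k) = 0#
  w q q⁻¹ d m r (suc n) zero    =
    pow q⁻¹ n * (0# - (m * qnum q d n + r) * w q q⁻¹ d m r n zero)
  w q q⁻¹ d m r (suc n) (suc k) =
    pow q⁻¹ n * (w q q⁻¹ d m r n k - (m * qnum q d n + r) * w q q⁻¹ d m r n (suc k))

module Submission where

-- Write e_g(n, l) for the l-th elementary symmetric function of the values
-- g 0, …, g (n-1), i.e. the sum over all increasing sequences
-- 0 ≤ i₁ < ⋯ < i_l ≤ n-1 of g i₁ ⋯ g i_l.  Splitting on whether n belongs
-- to the sequence gives the Pascal-type recurrence
--   e_g(n+1, l+1) = e_g(n, l+1) + e_g(n, l) · g n,
-- and e_g(n, l) = 0 for l > n.  Together with q⁻¹^C(n+1,2) = q⁻¹^n · q⁻¹^C(n,2)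
-- this shows that the closed form
--   F(n, j) = (-1)^j · q⁻¹^C(n,2) · e_g(n, j),   g i = r + [i]_q m,
-- obeys the defining recurrence of w(n, n - j), including its boundary
-- cases.  The identity is a formal
-- consequence of the recurrence: it holds in every commutative ring and for
-- arbitrary elements q⁻¹ and d.

open import Defs
open import Level using (Level)
open import Data.Nat as ℕ using (ℕ; zero; suc; _≤_; _<_; _∸_; s≤s)
open import Data.Nat.Properties as ℕₚ using (n<1+n; m<n⇒m<1+n; ≤-reflexive; m+[n∸m]≡n)
open import Data.Nat.Combinatorics using (_C_; nC1≡n; nCk+nC[k+1]≡[n+1]C[k+1])
open import Data.List using (List; []; _∷_; _++_; map; _∷ʳ_)
open import Data.List.Properties using (map-++)
open import Algebra.Bundles using (CommutativeRing)
open import Relation.Binary.PropositionalEquality as ≡ using (_≡_; cong)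
import Algebra.Solver.Ring.NaturalCoefficients.Default as SemiringSolver

incSeqs-tooLong : ∀ n l → n < l → incSeqs n l ≡ []
incSeqs-tooLong zero    (suc l) _           = ≡.refl
incSeqs-tooLong (suc n) (suc l) (s≤s n<l)
  rewrite incSeqs-tooLong n (suc l) (m<n⇒m<1+n n<l) | incSeqs-tooLong n l n<l = ≡.refl

choose2-suc : ∀ n → suc n C 2 ≡ n ℕ.+ n C 2
choose2-suc n = ≡.trans (≡.sym (nCk+nC[k+1]≡[n+1]C[k+1] n 1)) (cong (ℕ._+ n C 2) (nC1≡n n))

module _ {c ℓ : Level} (R : CommutativeRing c ℓ) where
  open CommutativeRing R
  open Whitney R
  open import Relation.Binary.Reasoning.Setoid setoid
  open import Algebra.Properties.Ring ring using (-1*x≈-x; -0#≈0#; -‿distribˡ-*; -‿distribʳ-*; -‿+-comm)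
  open SemiringSolver commutativeSemiring using (solve; _:=_; _:+_; _:*_)

  sumL-++ : ∀ xs ys → sumL (xs ++ ys) ≈ sumL xs + sumL ys
  sumL-++ []       ys = sym (+-identityˡ _)
  sumL-++ (x ∷ xs) ys = trans (+-congˡ (sumL-++ xs ys)) (sym (+-assoc _ _ _))

  prodL-∷ʳ : ∀ xs x → prodL (xs ∷ʳ x) ≈ prodL xs * x
  prodL-∷ʳ []       x = trans (*-identityʳ _) (sym (*-identityˡ _))
  prodL-∷ʳ (y ∷ xs) x = trans (*-congˡ (prodL-∷ʳ xs x)) (sym (*-assoc _ _ _))

  pow-+ : ∀ x a b → pow x (a ℕ.+ b) ≈ pow x a * pow x b
  pow-+ x zero    b = sym (*-identityˡ _)
  pow-+ x (suc a) b = trans (*-congˡ (pow-+ x a b)) (sym (*-assoc _ _ _))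

  module ElementarySymmetric (g : ℕ → Carrier) where

    monomial : List ℕ → Carrier
    monomial is = prodL (map g is)

    esym : ℕ → ℕ → Carrier
    esym n l = sumL (map monomial (incSeqs n l))

    sum-append : ∀ L n → sumL (map monomial (map (_∷ʳ n) L)) ≈ sumL (map monomial L) * g n
    sum-append []       n = sym (zeroˡ _)
    sum-append (is ∷ L) n = begin
      monomial (is ∷ʳ n) + sumL (map monomial (map (_∷ʳ n) L))
        ≈⟨ +-cong (reflexive (cong prodL (map-++ g is (n ∷ [])))) (sum-append L n) ⟩
      prodL (map g is ∷ʳ g n) + sumL (map monomial L) * g n
        ≈⟨ +-congʳ (prodL-∷ʳ (map g is) (g n)) ⟩
      monomial is * g n + sumL (map monomial L) * g n
        ≈⟨ sym (distribʳ _ _ _) ⟩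
      sumL (map monomial (is ∷ L)) * g n ∎

    -- Sequences in {0, …, n} either avoid n or end in n.
    esym-suc : ∀ n l → esym (suc n) (suc l) ≈ esym n (suc l) + esym n l * g n
    esym-suc n l = begin
      sumL (map monomial (incSeqs n (suc l) ++ map (_∷ʳ n) (incSeqs n l)))
        ≈⟨ reflexive (cong sumL (map-++ monomial (incSeqs n (suc l)) _)) ⟩
      sumL (map monomial (incSeqs n (suc l)) ++ map monomial (map (_∷ʳ n) (incSeqs n l)))
        ≈⟨ sumL-++ (map monomial (incSeqs n (suc l))) _ ⟩
      esym n (suc l) + sumL (map monomial (map (_∷ʳ n) (incSeqs n l)))
        ≈⟨ +-congˡ (sum-append (incSeqs n l) n) ⟩
      esym n (suc l) + esym n l * g n ∎

    esym-tooLong : ∀ n → esym n (suc n) ≈ 0#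
    esym-tooLong n = reflexive (cong (λ L → sumL (map monomial L)) (incSeqs-tooLong n (suc n) (n<1+n n)))

  module WhitneyFormula (q q⁻¹ d m r : Carrier) where

    W : ℕ → ℕ → Carrier
    W = w q q⁻¹ d m r

    g : ℕ → Carrier
    g i = r + qnum q d i * m

    open ElementarySymmetric g

    -- The recurrence operator: W (n+1) (k+1) = step n (W n k) (W n (k+1)),
    -- W (n+1) 0 = step n 0 (W n 0).
    step : ℕ → Carrier → Carrier → Carrier
    step n a b = pow q⁻¹ n * (a - (m * qnum q d n + r) * b)

    step-cong : ∀ n {a a′ b b′} → a ≈ a′ → b ≈ b′ → step n a b ≈ step n a′ b′
    step-cong n a≈a′ b≈b′ = *-congˡ (+-cong a≈a′ (-‿cong (*-congˡ b≈b′)))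

    step-zeroʳ : ∀ n a → step n a 0# ≈ pow q⁻¹ n * a
    step-zeroʳ n a = *-congˡ (trans (+-congˡ (trans (-‿cong (zeroʳ _)) -0#≈0#)) (+-identityʳ a))

    closedForm : ℕ → ℕ → Carrier
    closedForm n j = pow (- 1#) j * (pow q⁻¹ (n C 2) * esym n j)

    -- The normalising factor picks up exactly the q⁻¹^n of one step.
    q⁻¹-choose2-suc : ∀ n → pow q⁻¹ (suc n C 2) ≈ pow q⁻¹ n * pow q⁻¹ (n C 2)
    q⁻¹-choose2-suc n = trans (reflexive (cong (pow q⁻¹) (choose2-suc n))) (pow-+ q⁻¹ n (n C 2))

    -- Boundary case: F(n, n+1) = 0 plays the role of the missing W n (-1).
    closedForm-tooLong : ∀ n → closedForm n (suc n) ≈ 0#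
    closedForm-tooLong n = trans (*-congˡ (trans (*-congˡ (esym-tooLong n)) (zeroʳ _))) (zeroʳ _)

    step-negate : ∀ n a b → step n (- a) b ≈ - (pow q⁻¹ n * (a + (m * qnum q d n + r) * b))
    step-negate n a b = trans (*-congˡ (-‿+-comm a _)) (sym (-‿distribʳ-* (pow q⁻¹ n) _))

    closedForm-step : ∀ n j → step n (closedForm n (suc j)) (closedForm n j) ≈ closedForm (suc n) (suc j)
    closedForm-step n j = begin
      step n (closedForm n (suc j)) (closedForm n j)
        ≈⟨ step-cong n (trans (*-congʳ (-1*x≈-x s)) (sym (-‿distribˡ-* s _))) refl ⟩
      step n (- (s * (pow q⁻¹ (n C 2) * esym n (suc j)))) (closedForm n j)
        ≈⟨ step-negate n _ _ ⟩
      - (pow q⁻¹ n * (s * (pow q⁻¹ (n C 2) * esym n (suc j))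
                      + (m * qnum q d n + r) * (s * (pow q⁻¹ (n C 2) * esym n j))))
        ≈⟨ -‿cong (solve 8 (λ a s Q E₁ E₀ m′ [n] r′ →
                      a :* (s :* (Q :* E₁) :+ (m′ :* [n] :+ r′) :* (s :* (Q :* E₀)))
                      := s :* ((a :* Q) :* (E₁ :+ E₀ :* (r′ :+ [n] :* m′))))
                   refl (pow q⁻¹ n) s (pow q⁻¹ (n C 2))
                   (esym n (suc j)) (esym n j) m (qnum q d n) r) ⟩
      - (s * ((pow q⁻¹ n * pow q⁻¹ (n C 2)) * (esym n (suc j) + esym n j * g n)))
        ≈⟨ trans (-‿distribˡ-* s _) (*-congʳ (sym (-1*x≈-x s))) ⟩
      pow (- 1#) (suc j) * ((pow q⁻¹ n * pow q⁻¹ (n C 2)) * (esym n (suc j) + esym n j * g n))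
        ≈⟨ *-congˡ (*-cong (sym (q⁻¹-choose2-suc n)) (sym (esym-suc n j))) ⟩
      closedForm (suc n) (suc j) ∎
      where
      s : Carrier
      s = pow (- 1#) j

    -- Diagonal case: W (n+1) (n+1) = q⁻¹^n W n n, since W n (n+1) = 0.
    closedForm-diagonal : ∀ n → step n (closedForm n 0) 0# ≈ closedForm (suc n) 0
    closedForm-diagonal n = begin
      step n (1# * (pow q⁻¹ (n C 2) * esym n 0)) 0#
        ≈⟨ step-zeroʳ n _ ⟩
      pow q⁻¹ n * (1# * (pow q⁻¹ (n C 2) * esym n 0))
        ≈⟨ *-congˡ (*-identityˡ _) ⟩
      pow q⁻¹ n * (pow q⁻¹ (n C 2) * esym n 0)
        ≈⟨ sym (*-assoc _ _ _) ⟩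
      (pow q⁻¹ n * pow q⁻¹ (n C 2)) * esym n 0
        ≈⟨ *-congʳ (sym (q⁻¹-choose2-suc n)) ⟩
      pow q⁻¹ (suc n C 2) * esym (suc n) 0
        ≈⟨ sym (*-identityˡ _) ⟩
      closedForm (suc n) 0 ∎

    W-aboveDiagonal : ∀ n k → n < k → W n k ≈ 0#
    W-aboveDiagonal zero    (suc k) _         = refl
    W-aboveDiagonal (suc n) (suc k) (s≤s n<k) =
      trans (step-cong n (W-aboveDiagonal n k n<k) (W-aboveDiagonal n (suc k) (m<n⇒m<1+n n<k)))
            (trans (step-zeroʳ n 0#) (zeroʳ _))

    -- The three
    -- successor cases are k = 0 (closedForm-tooLong replaces the 0 of the
    -- recurrence), j = 0 (the diagonal) and the interior case.
    W≈closedForm : ∀ n k j → k ℕ.+ j ≡ n → W n k ≈ closedForm n j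
    W≈closedForm zero    zero    zero    ≡.refl = sym (trans (*-identityˡ _) (trans (*-identityˡ _) (+-identityʳ _)))
    W≈closedForm (suc n) zero    (suc j) ≡.refl =
      trans (step-cong n (sym (closedForm-tooLong n)) (W≈closedForm n 0 n ≡.refl)) (closedForm-step n n)
    W≈closedForm (suc n) (suc k) zero    ≡.refl =
      trans (step-cong (k ℕ.+ 0) (W≈closedForm (k ℕ.+ 0) k 0 ≡.refl)
                       (W-aboveDiagonal (k ℕ.+ 0) (suc k) (s≤s (≤-reflexive (ℕₚ.+-identityʳ k)))))
            (closedForm-diagonal (k ℕ.+ 0))
    W≈closedForm (suc n) (suc k) (suc j) ≡.refl =
      trans (step-cong (k ℕ.+ suc j) (W≈closedForm (k ℕ.+ suc j) k (suc j) ≡.refl)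
                                     (W≈closedForm (k ℕ.+ suc j) (suc k) j (≡.sym (ℕₚ.+-suc k j))))
            (closedForm-step (k ℕ.+ suc j) j)

theorem1 : {c ℓ : Level} (R : CommutativeRing c ℓ) →
    let open CommutativeRing R
        open Whitney R
    in (q q⁻¹ d m r : Carrier) →
       q * q⁻¹ ≈ 1# →
       (q - 1#) * d ≈ 1# →
       (n k : ℕ) → k ≤ n →
       w q q⁻¹ d m r n k
         ≈ pow (- 1#) (n ∸ k) * (pow q⁻¹ (n C 2)
             * sumL (map (λ is → prodL (map (λ i → r + qnum q d i * m) is))
                         (incSeqs n (n ∸ k))))
theorem1 R q q⁻¹ d m r _ _ n k k≤n =
  WhitneyFormula.W≈closedForm R q q⁻¹ d m r n k (n ∸ k) (m+[n∸m]≡n k≤n)
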